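{- Let $n\ge 24$. Then there exists a $6$-uniform hypergraph $\mathcal{H}=(V,\mathcal{E})$ with $EI(\mathcal{H})=C_n$ and $|\mathcal{E}|=\lceil n/2\rceil$. Moreover, $\mu^6_n=\lceil n/2\rceil$.
   Context: Hypergraphs $\mathcal{H}=(V,\mathcal{E})$ have no multiple hyperedges; isolated vertices are allowed. $\mathcal{H}$ is $k$-uniform if every hyperedge has exactly $k$ elements. The edge intersection hypergraph of $\mathcal{H}$ is $EI(\mathcal{H})=(V,\mathcal{E}^{EI})$ with $\mathcal{E}^{EI}=\{e_1\cap e_2: e_1,e_2\in\mathcal{E},\ e_1\ne e_2,\ |e_1\cap e_2|\ge 2\}$. $C_n$ is the cycle with vertex set $\{1,\dots,n\}$ and edges $\{i,i+1\}$, $i=1,\dots,n$ (indices mod $n$); "$EI(\mathcal{H})=C_n$" means $V=\{1,\dots,n\}$ and $\mathcal{E}^{EI}$ is exactly the edge set of $C_n$. $\mu^k_n$ is the minimum of $|\mathcal{E}|$ over all $k$-uniform $\mathcal{H}=(V,\mathcal{E})$ with $EI(\mathcal{H})=C_n$. -}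

module Defs where

open import Data.Nat using (ℕ; suc; _≤_; _∸_)
open import Data.Fin using (Fin; toℕ)
open import Data.Fin.Subset using (Subset; _∩_; _∪_; ⁅_⁆; ∣_∣)
open import Data.List using (List)
open import Data.List.Membership.Propositional using (_∈_)
open import Data.List.Relation.Unary.All using (All)
open import Data.List.Relation.Unary.Unique.Propositional using (Unique)
open import Data.Product using (Σ; _×_; ∃-syntax)
open import Data.Sum using (_⊎_)
open import Relation.Binary.PropositionalEquality using (_≡_; _≢_)
open import Function.Bundles using (_⇔_)

-- A hypergraph on vertex set Fin n (vertex i+1 of the paper is Fin index i):
-- a duplicate-free list of hyperedges (subsets of the vertex set).
-- Isolated vertices are allowed; |E| = length of the list.
record Hypergraph (n : ℕ) : Set where
  constructor hypergraph
  field
    edges  : List (Subset n)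
    unique : Unique edges

open Hypergraph public

Uniform : ∀ {n} → ℕ → Hypergraph n → Set
Uniform k H = All (λ e → ∣ e ∣ ≡ k) (edges H)

IsEIEdge : ∀ {n} → Hypergraph n → Subset n → Set
IsEIEdge H s =
  ∃[ e₁ ] ∃[ e₂ ] (e₁ ∈ edges H × e₂ ∈ edges H × e₁ ≢ e₂ × s ≡ e₁ ∩ e₂ × 2 ≤ ∣ s ∣)

CycleSucc : ∀ {n} → Fin n → Fin n → Set
CycleSucc {n} i j = toℕ j ≡ suc (toℕ i) ⊎ (toℕ i ≡ n ∸ 1 × toℕ j ≡ 0)

IsCycleEdge : ∀ {n} → Subset n → Set
IsCycleEdge s = ∃[ i ] ∃[ j ] (CycleSucc i j × s ≡ ⁅ i ⁆ ∪ ⁅ j ⁆)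

EIisCycle : ∀ {n} → Hypergraph n → Set
EIisCycle H = ∀ s → IsEIEdge H s ⇔ IsCycleEdge s

-- Lower bound: a vertex v of Cₙ lies on the cycle edges {v⁻, v} and {v, v⁺}, each the
-- intersection of two hyperedges.  Of the two hyperedges meeting in {v⁻, v} at least one misses
-- v⁺, and of those meeting in {v, v⁺} at least one misses v⁻; so v lies in three distinct
-- hyperedges, and double counting incidences gives 3n ≤ 6|E|, that is |E| ≥ ⌈n/2⌉.
--
-- Upper bound: write n = N₀ + 2K with N₀ ∈ {24, 25}.  The chain hyperedges
-- {2a, 2a+1, 2a+2, 2a+3, 2a+7, 2a+8} meet their successor in {2a+2, 2a+3}, the chain three
-- further on in {2a+7, 2a+8}, and every other chain in at most one vertex.  Four gadget
-- hyperedges, each a fixed part near 0 together with a part that moves with the end of the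
-- cycle, supply the remaining edges and close the cycle.  Every intersection that has to be
-- checked is then one of finitely many patterns independent of K, and these are decided by
-- evaluation.
module Submission where

open import Defs
open import Data.Bool using (Bool; true; false)
open import Data.Empty using (⊥; ⊥-elim)
open import Data.Fin using (Fin; zero; suc; toℕ; fromℕ; fromℕ<; inject₁; splitAt; _↑ˡ_; _↑ʳ_; #_)
import Data.Fin.Properties as Fin
open import Data.Fin.Properties
  using (toℕ-fromℕ; toℕ-fromℕ<; toℕ-inject₁; toℕ-injective; toℕ<n; splitAt-↑ˡ; splitAt-↑ʳ;
         splitAt⁻¹-↑ˡ; splitAt⁻¹-↑ʳ)
open import Data.Fin.Relation.Unary.Top using (view; ‵fromℕ; ‵inj₁)
open import Data.Fin.Subset using (Subset; inside; outside; _∈_; _∉_; _⊆_; _∩_; _∪_; _-_; ⁅_⁆; ∣_∣)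
open import Data.Fin.Subset.Properties
  using (_∈?_; ⊆-antisym; p⊆q⇒∣p∣≤∣q∣; ∣⊥∣≡0; Empty-unique; p─⊥≡p; p─q⊆p; x∈p∧x≢y⇒x∈p-y;
         x∈⁅x⁆; x∈⁅y⁆⇒x≡y; x∈p∩q⁺; x∈p∩q⁻; x∈p∪q⁺; x∈p∪q⁻; ∩-idem; ∩-comm)
open import Data.List as List
  using (List; []; _∷_; _++_; length; filter; map; lookup; tabulate; upTo; allFin)
import Data.List.Properties as List
open import Data.List.Membership.Propositional using () renaming (_∈_ to _∈ₗ_)
open import Data.List.Membership.Propositional.Properties
  using (∈-∃++; ∈-++⁻; ∈-++⁺ˡ; ∈-++⁺ʳ; ∈-filter⁺; ∈-filter⁻; ∈-map⁺; ∈-map⁻; ∈-tabulate⁺; ∈-tabulate⁻;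
         ∈-upTo⁺; ∈-allFin; ∈-lookup)
open import Data.List.Relation.Binary.Subset.Propositional using () renaming (_⊆_ to _⊆ₗ_)
open import Data.List.Relation.Unary.All as All using (All; []; _∷_)
import Data.List.Relation.Unary.All.Properties as All
open import Data.List.Relation.Unary.Any using (here; there)
open import Data.List.Relation.Unary.Unique.Propositional using (Unique; []; _∷_)
import Data.List.Relation.Unary.Unique.Propositional.Properties as Unique
open import Data.Nat
  using (ℕ; zero; suc; _+_; _*_; _≤_; _<_; z≤n; s≤s; _≟_; _≤?_; _<?_; ⌈_/2⌉)
open import Data.List.Membership.DecPropositional _≟_ using () renaming (_∈?_ to _∈ₗ?_)
open import Data.List.Relation.Unary.Unique.DecPropositional _≟_ using (unique?)
open import Data.Nat.Properties
  using (≤-refl; ≤-reflexive; ≤-trans; ≤-<-trans; <-irrefl; <⇒≢; <⇒≱; ≤⇒≯; ≮⇒≥; ≰⇒>;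
         n<1+n; n≤1+n; m<n⇒m<1+n; m≤n⇒m≤1+n; 1+n≢n; m≤m+n; m≤n+m; m≤n⇒∃[o]m+o≡n;
         +-comm; +-assoc; +-suc; +-mono-≤; +-monoˡ-≤; +-monoʳ-≤; +-monoˡ-<; +-cancelʳ-≡;
         +-cancelˡ-<; +-cancelʳ-<; *-suc; *-zeroʳ; *-comm; *-cancelˡ-≤;
         ⌈n/2⌉-mono; n≡⌈n+n/2⌉; n≡⌊n+n/2⌋; ≤-pred; +-commutativeSemigroup; module ≤-Reasoning)
open import Data.Nat.Tactic.RingSolver using (solve-∀)
open import Algebra.Properties.CommutativeSemigroup +-commutativeSemigroup using (interchange)
open import Data.Product using (Σ; _×_; _,_; proj₁; proj₂; ∃; ∃₂; ∃-syntax)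
open import Data.Product.Properties using (≡-dec)
open import Data.Sum using (_⊎_; inj₁; inj₂; [_,_]′)
open import Data.Unit using (⊤; tt)
open import Data.Vec as Vec using (Vec; []; _∷_; here; there; sum; zipWith; replicate)
open import Data.Vec.Properties
  using (lookup-zipWith; lookup-map; lookup-replicate; lookup∘tabulate; tabulate-cong; []=⇒lookup; lookup⇒[]=)
open import Function using (_∘_)
open import Function.Bundles using (_⇔_; mk⇔; Equivalence)
open import Relation.Binary.PropositionalEquality
  using (_≡_; _≢_; refl; sym; trans; cong; cong₂; subst; module ≡-Reasoning)
open import Relation.Nullary using (Dec; yes; no; does)
open import Relation.Nullary.Decidable using (from-yes; dec-true; does-⇔; map′; _×-dec_; _⊎-dec_; _→-dec_)

parity : ∀ u → ∃ λ a → u ≡ a + a ⊎ u ≡ suc (a + a)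
parity zero    = 0 , inj₁ refl
parity (suc u) with parity u
... | a , inj₁ refl = a , inj₂ refl
... | a , inj₂ refl = suc a , inj₁ (cong suc (sym (+-suc a a)))

halve : ∀ {u L} → u < L + L → ∃ λ a → a < L × (u ≡ a + a ⊎ u ≡ suc (a + a))
halve {u} {L} u<2L with a , u≡ ← parity u with a <? L
... | yes a<L = a , a<L , u≡
... | no  a≮L = ⊥-elim (<-irrefl refl (≤-<-trans (≤-trans (+-mono-≤ L≤a L≤a) 2a≤u) u<2L))
  where
  L≤a = ≮⇒≥ a≮L
  2a≤u : a + a ≤ u
  2a≤u = [ ≤-reflexive ∘ sym , (λ u≡1+2a → subst (a + a ≤_) (sym u≡1+2a) (n≤1+n (a + a))) ]′ u≡

≤-or-gap : ∀ a K → (∃ λ r → K ≡ r + a) ⊎ (∃ λ t → a ≡ suc t + K)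
≤-or-gap a K with a ≤? K
... | yes a≤K with r , refl ← m≤n⇒∃[o]m+o≡n a≤K = inj₁ (r , +-comm a r)
... | no  a≰K with t , refl ← m≤n⇒∃[o]m+o≡n (≰⇒> a≰K) = inj₂ (t , cong suc (+-comm K t))

unique-⊆-length : ∀ {A : Set} {xs ys : List A} → Unique ys → ys ⊆ₗ xs → length ys ≤ length xs
unique-⊆-length [] _ = z≤n
unique-⊆-length {ys = y ∷ ys} (y∉ys ∷ ys!) ys⊆xs
  with l , r , refl ← ∈-∃++ (ys⊆xs (here refl)) = begin
    suc (length ys)       ≤⟨ s≤s (unique-⊆-length ys! ys⊆l++r) ⟩
    suc (length (l ++ r)) ≡⟨ List.length-++-sucʳ l y r ⟨
    length (l ++ y ∷ r)   ∎
  where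
  open ≤-Reasoning
  ys⊆l++r : ys ⊆ₗ l ++ r
  ys⊆l++r z∈ys with ∈-++⁻ l (ys⊆xs (there z∈ys))
  ... | inj₁ z∈l         = ∈-++⁺ˡ z∈l
  ... | inj₂ (here refl) = ⊥-elim (All.lookup y∉ys z∈ys refl)
  ... | inj₂ (there z∈r) = ∈-++⁺ʳ l z∈r

∣p∣≡1+∣p-x∣ : ∀ {n} {x : Fin n} {p : Subset n} → x ∈ p → ∣ p ∣ ≡ suc ∣ p - x ∣
∣p∣≡1+∣p-x∣ {p = inside ∷ p}  here        = cong suc (cong ∣_∣ (sym (p─⊥≡p p)))
∣p∣≡1+∣p-x∣ {p = inside ∷ p}  (there x∈p) = cong suc (∣p∣≡1+∣p-x∣ x∈p)
∣p∣≡1+∣p-x∣ {p = outside ∷ p} (there x∈p) = ∣p∣≡1+∣p-x∣ x∈p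

x∉p-x : ∀ {n} {x : Fin n} (p : Subset n) → x ∉ p - x
x∉p-x {x = zero}  (_ ∷ p) ()
x∉p-x {x = suc x} (_ ∷ p) (there x∈p-x) = x∉p-x p x∈p-x

∈-pair⁺ : ∀ {n} {x y z : Fin n} → z ≡ x ⊎ z ≡ y → z ∈ ⁅ x ⁆ ∪ ⁅ y ⁆
∈-pair⁺ (inj₁ refl) = x∈p∪q⁺ (inj₁ (x∈⁅x⁆ _))
∈-pair⁺ (inj₂ refl) = x∈p∪q⁺ (inj₂ (x∈⁅x⁆ _))

∈-pair⁻ : ∀ {n} {x y z : Fin n} → z ∈ ⁅ x ⁆ ∪ ⁅ y ⁆ → z ≡ x ⊎ z ≡ y
∈-pair⁻ {x = x} {y} z∈ with x∈p∪q⁻ ⁅ x ⁆ ⁅ y ⁆ z∈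
... | inj₁ z∈x = inj₁ (x∈⁅y⁆⇒x≡y x z∈x)
... | inj₂ z∈y = inj₂ (x∈⁅y⁆⇒x≡y y z∈y)

-- The lower bound

module _ {n : ℕ} where

  cycleSucc-irrefl : ∀ {x y : Fin n} → 2 ≤ n → CycleSucc x y → x ≢ y
  cycleSucc-irrefl _ (inj₁ y≡1+x) refl = 1+n≢n (sym y≡1+x)
  cycleSucc-irrefl (s≤s (s≤s _)) (inj₂ (x≡n-1 , y≡0)) refl with trans (sym x≡n-1) y≡0
  ... | ()

  cycleSucc-asym : ∀ {x y : Fin n} → 3 ≤ n → CycleSucc x y → CycleSucc y x → ⊥
  cycleSucc-asym _ (inj₁ y≡1+x) (inj₁ x≡1+y) = <⇒≢ (m<n⇒m<1+n (n<1+n _)) (trans x≡1+y (cong suc y≡1+x))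
  cycleSucc-asym (s≤s (s≤s (s≤s _))) (inj₁ y≡1+x) (inj₂ (y≡n-1 , x≡0))
    with trans (sym y≡n-1) (trans y≡1+x (cong suc x≡0))
  ... | ()
  cycleSucc-asym (s≤s (s≤s (s≤s _))) (inj₂ (x≡n-1 , y≡0)) (inj₁ x≡1+y)
    with trans (sym x≡n-1) (trans x≡1+y (cong suc y≡0))
  ... | ()
  cycleSucc-asym (s≤s (s≤s (s≤s _))) (inj₂ (x≡n-1 , y≡0)) (inj₂ (y≡n-1 , _))
    with trans (sym y≡n-1) y≡0
  ... | ()

predecessor : ∀ {n} (v : Fin (suc n)) → ∃[ p ] CycleSucc p v
predecessor {n} zero = fromℕ n , inj₂ (toℕ-fromℕ n , refl)
predecessor (suc v)  = inject₁ v , inj₁ (cong suc (sym (toℕ-inject₁ v)))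

successor : ∀ {n} (v : Fin (suc n)) → ∃[ s ] CycleSucc v s
successor v with view v
... | ‵fromℕ          = zero , inj₂ (toℕ-fromℕ _ , refl)
... | ‵inj₁ {i = w} _ = suc w , inj₁ (cong suc (sym (toℕ-inject₁ w)))

record Straddle {n} (H : Hypergraph n) (x y z : Fin n) : Set where
  field
    {a b} : Subset n
    a∈E   : a ∈ₗ edges H
    b∈E   : b ∈ₗ edges H
    a≢b   : a ≢ b
    x∈a   : x ∈ a
    x∈b   : x ∈ b
    y∈a   : y ∈ a
    y∈b   : y ∈ b
    z∉a   : z ∉ a

straddle : ∀ {n} {H : Hypergraph n} {x y z : Fin n} → EIisCycle H → CycleSucc x y →
           z ≢ x → z ≢ y → Straddle H x y z
straddle {H = H} {x} {y} {z} ei xy z≢x z≢y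
  with e₁ , e₂ , e₁∈E , e₂∈E , e₁≢e₂ , xy≡e₁∩e₂ , _ ← Equivalence.from (ei _) (x , y , xy , refl)
  = pick (z ∈? e₁)
  where
  in-both : ∀ {w} → w ≡ x ⊎ w ≡ y → w ∈ e₁ × w ∈ e₂
  in-both w≡ = x∈p∩q⁻ e₁ e₂ (subst (_ ∈_) xy≡e₁∩e₂ (∈-pair⁺ w≡))
  not-both : z ∈ e₁ → z ∉ e₂
  not-both z∈e₁ z∈e₂ with ∈-pair⁻ (subst (z ∈_) (sym xy≡e₁∩e₂) (x∈p∩q⁺ (z∈e₁ , z∈e₂)))
  ... | inj₁ z≡x = z≢x z≡x
  ... | inj₂ z≡y = z≢y z≡y
  pick : Dec (z ∈ e₁) → Straddle H x y z
  pick (yes z∈e₁) = record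
    { a∈E = e₂∈E ; b∈E = e₁∈E ; a≢b = λ e → e₁≢e₂ (sym e)
    ; x∈a = proj₂ (in-both (inj₁ refl)) ; x∈b = proj₁ (in-both (inj₁ refl))
    ; y∈a = proj₂ (in-both (inj₂ refl)) ; y∈b = proj₁ (in-both (inj₂ refl))
    ; z∉a = not-both z∈e₁ }
  pick (no z∉e₁) = record
    { a∈E = e₁∈E ; b∈E = e₂∈E ; a≢b = e₁≢e₂
    ; x∈a = proj₁ (in-both (inj₁ refl)) ; x∈b = proj₂ (in-both (inj₁ refl))
    ; y∈a = proj₁ (in-both (inj₂ refl)) ; y∈b = proj₂ (in-both (inj₂ refl))
    ; z∉a = z∉e₁ }

degree : ∀ {n} → Fin n → List (Subset n) → ℕ
degree v E = length (filter (v ∈?_) E)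

degree≥3 : ∀ {n} {H : Hypergraph n} → 3 ≤ n → EIisCycle H → ∀ v → 3 ≤ degree v (edges H)
degree≥3 {suc n} {H} 3≤n ei v = unique-⊆-length distinct through-v
  where
  p = proj₁ (predecessor v)
  s = proj₁ (successor v)
  pv = proj₂ (predecessor v)
  vs = proj₂ (successor v)
  2≤n = ≤-trans (s≤s (s≤s z≤n)) 3≤n
  module L = Straddle (straddle {H = H} {z = s} ei pv
                         (λ s≡p → cycleSucc-asym 3≤n pv (subst (CycleSucc v) s≡p vs))
                         (λ s≡v → cycleSucc-irrefl 2≤n vs (sym s≡v)))
  module R = Straddle (straddle {H = H} {z = p} ei vs
                         (cycleSucc-irrefl 2≤n pv)
                         (λ p≡s → cycleSucc-asym 3≤n pv (subst (CycleSucc v) (sym p≡s) vs)))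
  distinct : Unique (L.a ∷ L.b ∷ R.a ∷ [])
  distinct = (L.a≢b ∷ (λ e → L.z∉a (subst (s ∈_) (sym e) R.y∈a)) ∷ [])
           ∷ ((λ e → R.z∉a (subst (p ∈_) e L.x∈b)) ∷ [])
           ∷ [] ∷ []
  through-v : (L.a ∷ L.b ∷ R.a ∷ []) ⊆ₗ filter (v ∈?_) (edges H)
  through-v (here refl)                 = ∈-filter⁺ (v ∈?_) L.a∈E L.y∈a
  through-v (there (here refl))         = ∈-filter⁺ (v ∈?_) L.b∈E L.y∈b
  through-v (there (there (here refl))) = ∈-filter⁺ (v ∈?_) R.a∈E R.x∈a

bit : Bool → ℕ
bit true  = 1
bit false = 0

degrees : ∀ {n} → List (Subset n) → Vec ℕ n
degrees = List.foldr (λ e d → zipWith _+_ (Vec.map bit e) d) (replicate _ 0)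

sum-bits : ∀ {n} (p : Subset n) → sum (Vec.map bit p) ≡ ∣ p ∣
sum-bits []            = refl
sum-bits (inside ∷ p)  = cong suc (sum-bits p)
sum-bits (outside ∷ p) = sum-bits p

sum-zipWith-+ : ∀ {n} (u w : Vec ℕ n) → sum (zipWith _+_ u w) ≡ sum u + sum w
sum-zipWith-+ []      []      = refl
sum-zipWith-+ (x ∷ u) (y ∷ w) = trans (cong (x + y +_) (sum-zipWith-+ u w)) (interchange x y (sum u) (sum w))

sum-replicate-0 : ∀ n → sum (replicate n 0) ≡ 0
sum-replicate-0 zero    = refl
sum-replicate-0 (suc n) = sum-replicate-0 n

sum-degrees : ∀ {n k} (E : List (Subset n)) → All (λ e → ∣ e ∣ ≡ k) E → sum (degrees E) ≡ k * length E
sum-degrees {n} {k} []      []                = trans (sum-replicate-0 n) (sym (*-zeroʳ k))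
sum-degrees {n} {k} (e ∷ E) (∣e∣≡k ∷ uniform) = begin
  sum (zipWith _+_ (Vec.map bit e) (degrees E)) ≡⟨ sum-zipWith-+ (Vec.map bit e) (degrees E) ⟩
  sum (Vec.map bit e) + sum (degrees E)         ≡⟨ cong₂ _+_ (trans (sum-bits e) ∣e∣≡k) (sum-degrees E uniform) ⟩
  k + k * length E                              ≡⟨ *-suc k _ ⟨
  k * suc (length E)                            ∎
  where open ≡-Reasoning

does-∈? : ∀ {n} (v : Fin n) (p : Subset n) → does (v ∈? p) ≡ Vec.lookup p v
does-∈? zero    (inside ∷ p)  = refl
does-∈? zero    (outside ∷ p) = refl
does-∈? (suc v) (_ ∷ p)       = does-∈? v p

lookup-degrees : ∀ {n} (E : List (Subset n)) (v : Fin n) → Vec.lookup (degrees E) v ≡ degree v E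
lookup-degrees []      v = lookup-replicate v 0
lookup-degrees (e ∷ E) v
  rewrite lookup-zipWith _+_ v (Vec.map bit e) (degrees E) | lookup-map v bit e
        | lookup-degrees E v | sym (does-∈? v e)
  with does (v ∈? e)
... | true  = refl
... | false = refl

sum-lower-bound : ∀ {n c} (w : Vec ℕ n) → (∀ i → c ≤ Vec.lookup w i) → n * c ≤ sum w
sum-lower-bound []      _  = z≤n
sum-lower-bound (x ∷ w) c≤ = +-mono-≤ (c≤ zero) (sum-lower-bound w (c≤ ∘ suc))

incidence-bound : ∀ {n k} (H : Hypergraph n) → 3 ≤ n → Uniform k H → EIisCycle H →
                  3 * n ≤ k * length (edges H)
incidence-bound {n} {k} H 3≤n uniform ei = begin
  3 * n                   ≡⟨ *-comm 3 n ⟩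
  n * 3                   ≤⟨ sum-lower-bound (degrees (edges H)) deg≥3 ⟩
  sum (degrees (edges H)) ≡⟨ sum-degrees (edges H) uniform ⟩
  k * length (edges H)    ∎
  where
  open ≤-Reasoning
  deg≥3 : ∀ v → 3 ≤ Vec.lookup (degrees (edges H)) v
  deg≥3 v = subst (3 ≤_) (sym (lookup-degrees (edges H) v)) (degree≥3 {H = H} 3≤n ei v)

half-bound : ∀ {n} (H : Hypergraph n) → 3 ≤ n → Uniform 6 H → EIisCycle H → ⌈ n /2⌉ ≤ length (edges H)
half-bound {n} H 3≤n uniform ei = subst (⌈ n /2⌉ ≤_) (sym (n≡⌈n+n/2⌉ m)) (⌈n/2⌉-mono n≤2m)
  where
  m = length (edges H)
  six : ∀ m → 6 * m ≡ 3 * (m + m)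
  six = solve-∀
  n≤2m : n ≤ m + m
  n≤2m = *-cancelˡ-≤ 3 (subst (3 * n ≤_) (six m) (incidence-bound H 3≤n uniform ei))

-- Realising lists of vertices as subsets

module Realisation (n : ℕ) where

  private
    variable
      V W I : List ℕ

  -- Entries that are not below n are ignored.
  ⟦_⟧ : List ℕ → Subset n
  ⟦ V ⟧ = Vec.tabulate (λ i → does (toℕ i ∈ₗ? V))

  ∈⟦⟧⁺ : {i : Fin n} → toℕ i ∈ₗ V → i ∈ ⟦ V ⟧
  ∈⟦⟧⁺ {V} {i} i∈V = lookup⇒[]= i _ (trans (lookup∘tabulate _ i) (dec-true (toℕ i ∈ₗ? V) i∈V))

  ∈⟦⟧⁻ : {i : Fin n} → i ∈ ⟦ V ⟧ → toℕ i ∈ₗ V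
  ∈⟦⟧⁻ {V} {i} i∈⟦V⟧ with toℕ i ∈ₗ? V | trans (sym (lookup∘tabulate _ i)) ([]=⇒lookup i∈⟦V⟧)
  ... | yes i∈V | _ = i∈V
  ... | no _    | ()

  ⟦⟧-cong : (∀ (i : Fin n) → toℕ i ∈ₗ V ⇔ toℕ i ∈ₗ W) → ⟦ V ⟧ ≡ ⟦ W ⟧
  ⟦⟧-cong {V} {W} V⇔W = tabulate-cong (λ i → does-⇔ (V⇔W i) (toℕ i ∈ₗ? V) (toℕ i ∈ₗ? W))

  ⟦⟧-∩ : (∀ k → (k ∈ₗ V × k ∈ₗ W) ⇔ k ∈ₗ I) → ⟦ V ⟧ ∩ ⟦ W ⟧ ≡ ⟦ I ⟧
  ⟦⟧-∩ {V} {W} meet = ⊆-antisym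
    (λ i∈ → let i∈V , i∈W = x∈p∩q⁻ ⟦ V ⟧ ⟦ W ⟧ i∈ in ∈⟦⟧⁺ (Equivalence.to (meet _) (∈⟦⟧⁻ i∈V , ∈⟦⟧⁻ i∈W)))
    (λ i∈ → let i∈V , i∈W = Equivalence.from (meet _) (∈⟦⟧⁻ i∈) in x∈p∩q⁺ (∈⟦⟧⁺ i∈V , ∈⟦⟧⁺ i∈W))

  ⟦⟧-swap : ∀ {u v} → ⟦ u ∷ v ∷ [] ⟧ ≡ ⟦ v ∷ u ∷ [] ⟧
  ⟦⟧-swap = ⟦⟧-cong (λ _ → mk⇔ swap swap)
    where
    swap : ∀ {k a b} → k ∈ₗ a ∷ b ∷ [] → k ∈ₗ b ∷ a ∷ []
    swap (here k≡a)         = there (here k≡a)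
    swap (there (here k≡b)) = here k≡b

  ∣⟦[]⟧∣≡0 : ∣ ⟦ [] ⟧ ∣ ≡ 0
  ∣⟦[]⟧∣≡0 = trans (cong ∣_∣ (Empty-unique λ { (_ , i∈) → absurd (∈⟦⟧⁻ i∈) })) (∣⊥∣≡0 n)
    where
    absurd : ∀ {k} → k ∈ₗ [] → ⊥
    absurd ()

  module _ {v : ℕ} {V : List ℕ} (v<n : v < n) where

    private
      x : Fin n
      x = fromℕ< v<n

    x∈⟦v∷V⟧ : x ∈ ⟦ v ∷ V ⟧
    x∈⟦v∷V⟧ = ∈⟦⟧⁺ {v ∷ V} (here (toℕ-fromℕ< v<n))

    ⟦v∷V⟧-x⊆⟦V⟧ : ⟦ v ∷ V ⟧ - x ⊆ ⟦ V ⟧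
    ⟦v∷V⟧-x⊆⟦V⟧ {i} i∈ with ∈⟦⟧⁻ {v ∷ V} (p─q⊆p _ _ i∈)
    ... | here i≡v  = ⊥-elim (x∉p-x ⟦ v ∷ V ⟧ (subst (_∈ ⟦ v ∷ V ⟧ - x) i≡x i∈))
      where i≡x = toℕ-injective (trans i≡v (sym (toℕ-fromℕ< v<n)))
    ... | there i∈V = ∈⟦⟧⁺ i∈V

    ⟦V⟧⊆⟦v∷V⟧-x : All (v ≢_) V → ⟦ V ⟧ ⊆ ⟦ v ∷ V ⟧ - x
    ⟦V⟧⊆⟦v∷V⟧-x v∉V {i} i∈ = x∈p∧x≢y⇒x∈p-y (∈⟦⟧⁺ {v ∷ V} (there i∈V)) i≢x
      where
      i∈V = ∈⟦⟧⁻ {V} i∈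
      i≢x : i ≢ x
      i≢x refl = All.lookup v∉V i∈V (sym (toℕ-fromℕ< v<n))

  ∣⟦⟧∣≤length : ∀ V → ∣ ⟦ V ⟧ ∣ ≤ length V
  ∣⟦⟧∣≤length []      = ≤-reflexive ∣⟦[]⟧∣≡0
  ∣⟦⟧∣≤length (v ∷ V) with v <? n
  ... | yes v<n = begin
    ∣ ⟦ v ∷ V ⟧ ∣                   ≡⟨ ∣p∣≡1+∣p-x∣ (x∈⟦v∷V⟧ {V = V} v<n) ⟩
    suc ∣ ⟦ v ∷ V ⟧ - fromℕ< v<n ∣  ≤⟨ s≤s (p⊆q⇒∣p∣≤∣q∣ (⟦v∷V⟧-x⊆⟦V⟧ {V = V} v<n)) ⟩
    suc ∣ ⟦ V ⟧ ∣                   ≤⟨ s≤s (∣⟦⟧∣≤length V) ⟩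
    suc (length V)                  ∎
    where open ≤-Reasoning
  ... | no v≮n = m≤n⇒m≤1+n (≤-trans (p⊆q⇒∣p∣≤∣q∣ out-of-range) (∣⟦⟧∣≤length V))
    where
    out-of-range : ⟦ v ∷ V ⟧ ⊆ ⟦ V ⟧
    out-of-range {i} i∈ with ∈⟦⟧⁻ {v ∷ V} i∈
    ... | here i≡v  = ⊥-elim (v≮n (subst (_< n) i≡v (toℕ<n i)))
    ... | there i∈V = ∈⟦⟧⁺ i∈V

  ∣⟦⟧∣≡length : Unique V → All (_< n) V → ∣ ⟦ V ⟧ ∣ ≡ length V
  ∣⟦⟧∣≡length []            []              = ∣⟦[]⟧∣≡0
  ∣⟦⟧∣≡length {v ∷ V} (v∉V ∷ V!) (v<n ∷ V<n) = begin
    ∣ ⟦ v ∷ V ⟧ ∣                   ≡⟨ ∣p∣≡1+∣p-x∣ (x∈⟦v∷V⟧ {V = V} v<n) ⟩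
    suc ∣ ⟦ v ∷ V ⟧ - fromℕ< v<n ∣  ≡⟨ cong (suc ∘ ∣_∣) (⊆-antisym (⟦v∷V⟧-x⊆⟦V⟧ {V = V} v<n)
                                                                  (⟦V⟧⊆⟦v∷V⟧-x v<n v∉V)) ⟩
    suc ∣ ⟦ V ⟧ ∣                   ≡⟨ cong suc (∣⟦⟧∣≡length V! V<n) ⟩
    suc (length V)                  ∎
    where open ≡-Reasoning

  ⟦⟧-edge : ∀ {x y : Fin n} {u v} → toℕ x ≡ u → toℕ y ≡ v → ⟦ u ∷ v ∷ [] ⟧ ≡ ⁅ x ⁆ ∪ ⁅ y ⁆
  ⟦⟧-edge {x} {y} refl refl = ⊆-antisym (λ i∈ → ∈-pair⁺ (to (∈⟦⟧⁻ {toℕ x ∷ toℕ y ∷ []} i∈)))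
                                        (λ i∈ → ∈⟦⟧⁺ (from (∈-pair⁻ i∈)))
    where
    to : ∀ {i} → toℕ i ∈ₗ toℕ x ∷ toℕ y ∷ [] → i ≡ x ⊎ i ≡ y
    to (here i≡x)         = inj₁ (toℕ-injective i≡x)
    to (there (here i≡y)) = inj₂ (toℕ-injective i≡y)
    from : ∀ {i} → i ≡ x ⊎ i ≡ y → toℕ i ∈ₗ toℕ x ∷ toℕ y ∷ []
    from (inj₁ refl) = here refl
    from (inj₂ refl) = there (here refl)

  step-cycleEdge : ∀ {u} → suc u < n → IsCycleEdge ⟦ u ∷ suc u ∷ [] ⟧
  step-cycleEdge 1+u<n = fromℕ< u<n , fromℕ< 1+u<n ,
    inj₁ (trans (toℕ-fromℕ< 1+u<n) (cong suc (sym (toℕ-fromℕ< u<n)))) ,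
    ⟦⟧-edge (toℕ-fromℕ< u<n) (toℕ-fromℕ< 1+u<n)
    where u<n = ≤-trans (n≤1+n _) 1+u<n

  wrap-cycleEdge : ∀ {w} → n ≡ suc w → IsCycleEdge ⟦ w ∷ 0 ∷ [] ⟧
  wrap-cycleEdge {w} refl = fromℕ< (≤-refl {suc w}) , fromℕ< (s≤s (z≤n {w})) ,
    inj₂ (toℕ-fromℕ< (≤-refl {suc w}) , toℕ-fromℕ< (s≤s (z≤n {w}))) ,
    ⟦⟧-edge (toℕ-fromℕ< (≤-refl {suc w})) (toℕ-fromℕ< (s≤s (z≤n {w})))

  ∣pair∣≡2 : ∀ {x y : Fin n} → x ≢ y → ∣ ⁅ x ⁆ ∪ ⁅ y ⁆ ∣ ≡ 2
  ∣pair∣≡2 {x} {y} x≢y = trans (cong ∣_∣ (sym (⟦⟧-edge refl refl)))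
    (∣⟦⟧∣≡length (((λ eq → x≢y (toℕ-injective eq)) ∷ []) ∷ [] ∷ []) (toℕ<n x ∷ toℕ<n y ∷ []))

  Admissible : Subset n → Set
  Admissible p = ∣ p ∣ ≤ 1 ⊎ IsCycleEdge p

  -- The e i are pairwise distinct for free: k > 2 makes e i ∩ e i = e i inadmissible.
  module Certified {k N : ℕ} (e : Fin N → Subset n) (2≤n : 2 ≤ n) (2<k : 2 < k)
    (size       : ∀ i → ∣ e i ∣ ≡ k)
    (admissible : ∀ {i j} → i ≢ j → Admissible (e i ∩ e j))
    (covered    : ∀ {x y} → CycleSucc x y → ∃₂ λ i j → e i ∩ e j ≡ ⁅ x ⁆ ∪ ⁅ y ⁆)
    where

    cycleEdge-size : ∀ {s : Subset n} → IsCycleEdge s → ∣ s ∣ ≡ 2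
    cycleEdge-size (_ , _ , xy , refl) = ∣pair∣≡2 (cycleSucc-irrefl 2≤n xy)

    k≢2 : k ≢ 2
    k≢2 refl = <-irrefl refl 2<k

    self-inadmissible : ∀ i → Admissible (e i ∩ e i) → ⊥
    self-inadmissible i adm rewrite ∩-idem (e i) with adm
    ... | inj₁ ∣ei∣≤1 = <⇒≱ 2<k (≤-trans (≤-reflexive (sym (size i))) (≤-trans ∣ei∣≤1 (s≤s z≤n)))
    ... | inj₂ cycle  = k≢2 (trans (sym (size i)) (cycleEdge-size cycle))

    e-injective : ∀ {i j} → e i ≡ e j → i ≡ j
    e-injective {i} {j} ei≡ej with i Fin.≟ j
    ... | yes i≡j = i≡j
    ... | no  i≢j = ⊥-elim (self-inadmissible i (subst (λ q → Admissible (e i ∩ q)) (sym ei≡ej) (admissible i≢j)))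

    H : Hypergraph n
    H = hypergraph (tabulate e) (Unique.tabulate⁺ e-injective)

    ei⇒cycle : ∀ {s : Subset n} → IsEIEdge H s → IsCycleEdge s
    ei⇒cycle (_ , _ , e₁∈ , e₂∈ , e₁≢e₂ , refl , 2≤∣s∣)
      with i , refl ← ∈-tabulate⁻ e₁∈ | j , refl ← ∈-tabulate⁻ e₂∈
      with admissible {i} {j} (λ i≡j → e₁≢e₂ (cong e i≡j))
    ... | inj₁ ∣s∣≤1 = ⊥-elim (≤⇒≯ ∣s∣≤1 2≤∣s∣)
    ... | inj₂ cycle = cycle

    cycle⇒ei : ∀ {s : Subset n} → IsCycleEdge s → IsEIEdge H s
    cycle⇒ei cycle@(x , y , xy , refl) with i , j , ei∩ej≡s ← covered xy =
      e i , e j , ∈-tabulate⁺ i , ∈-tabulate⁺ j , ei≢ej , sym ei∩ej≡s ,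
      ≤-reflexive (sym (cycleEdge-size cycle))
      where
      ei≢ej : e i ≢ e j
      ei≢ej ei≡ej = k≢2 (begin
        k                  ≡⟨ size i ⟨
        ∣ e i ∣            ≡⟨ cong ∣_∣ (∩-idem (e i)) ⟨
        ∣ e i ∩ e i ∣      ≡⟨ cong (λ q → ∣ e i ∩ q ∣) ei≡ej ⟩
        ∣ e i ∩ e j ∣      ≡⟨ cong ∣_∣ ei∩ej≡s ⟩
        ∣ ⁅ x ⁆ ∪ ⁅ y ⁆ ∣  ≡⟨ cycleEdge-size cycle ⟩
        2                  ∎)
        where open ≡-Reasoning

    certified : Σ (Hypergraph n) λ H → Uniform k H × EIisCycle H × length (edges H) ≡ N
    certified = H , All.tabulate⁺ size , (λ _ → mk⇔ ei⇒cycle cycle⇒ei) , List.length-tabulate e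

-- High vertices move with the end of the cycle, which advances by 2 with each step in height.
Shape : Set
Shape = List ℕ × List ℕ

values : ℕ → Shape → List ℕ
values X (low , high) = low ++ map (_+ (X + X)) high

raise : ℕ → Shape → Shape
raise d (low , high) = low , map (_+ d) high

freeze : ℕ → Shape → Shape
freeze X s = values X s , []

values-raise : ∀ d X s → values (d + X) s ≡ values X (raise (d + d) s)
values-raise d X (low , high) = cong (low ++_) (begin
  map (_+ ((d + X) + (d + X))) high         ≡⟨ List.map-cong regroup high ⟩
  map ((_+ (X + X)) ∘ (_+ (d + d))) high    ≡⟨ List.map-∘ high ⟩
  map (_+ (X + X)) (map (_+ (d + d)) high)  ∎)
  where
  open ≡-Reasoning
  regroup : ∀ o → o + ((d + X) + (d + X)) ≡ (o + (d + d)) + (X + X)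
  regroup o = trans (cong (o +_) (interchange d X d X)) (sym (+-assoc o (d + d) (X + X)))

values-freeze : ∀ X Y s → values Y (freeze X s) ≡ values X s
values-freeze X Y s = List.++-identityʳ (values X s)

_∩ₗ_ : List ℕ → List ℕ → List ℕ
V ∩ₗ W = filter (_∈ₗ? W) V

_⊓_ : Shape → Shape → Shape
(l₁ , h₁) ⊓ (l₂ , h₂) = l₁ ∩ₗ l₂ , h₁ ∩ₗ h₂

Below : List ℕ → List ℕ → Set
Below V W = All (λ v → All (v <_) W) V

Separated : Shape → Shape → Set
Separated (l₁ , h₁) (l₂ , h₂) = Below l₁ h₂ × Below l₂ h₁

below-raised : ∀ {V W d k} → Below V W → k ∈ₗ V → k ∈ₗ map (_+ d) W → ⊥
below-raised {d = d} V<W k∈V k∈W+d with ∈-map⁻ (_+ d) k∈W+d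
... | o , o∈W , refl = ≤⇒≯ (m≤m+n o d) (All.lookup (All.lookup V<W k∈V) o∈W)

-- In a separated pair no low vertex meets a shifted high vertex, so the meet is taken part by part.
meet : ∀ {s t} → Separated s t → ∀ X k → (k ∈ₗ values X s × k ∈ₗ values X t) ⇔ k ∈ₗ values X (s ⊓ t)
meet {l₁ , h₁} {l₂ , h₂} (l₁<h₂ , l₂<h₁) X k = mk⇔ to from
  where
  to : k ∈ₗ values X (l₁ , h₁) × k ∈ₗ values X (l₂ , h₂) → k ∈ₗ values X ((l₁ , h₁) ⊓ (l₂ , h₂))
  to (k∈s , k∈t) with ∈-++⁻ l₁ k∈s | ∈-++⁻ l₂ k∈t
  ... | inj₁ k∈l₁ | inj₁ k∈l₂ = ∈-++⁺ˡ (∈-filter⁺ (_∈ₗ? l₂) k∈l₁ k∈l₂)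
  ... | inj₁ k∈l₁ | inj₂ k∈h₂ = ⊥-elim (below-raised l₁<h₂ k∈l₁ k∈h₂)
  ... | inj₂ k∈h₁ | inj₁ k∈l₂ = ⊥-elim (below-raised l₂<h₁ k∈l₂ k∈h₁)
  ... | inj₂ k∈h₁ | inj₂ k∈h₂ with ∈-map⁻ (_+ (X + X)) k∈h₁ | ∈-map⁻ (_+ (X + X)) k∈h₂
  ... | o , o∈h₁ , refl | o′ , o′∈h₂ , eq with +-cancelʳ-≡ (X + X) o o′ eq
  ... | refl = ∈-++⁺ʳ (l₁ ∩ₗ l₂) (∈-map⁺ (_+ (X + X)) (∈-filter⁺ (_∈ₗ? h₂) o∈h₁ o′∈h₂))
  from : k ∈ₗ values X ((l₁ , h₁) ⊓ (l₂ , h₂)) → k ∈ₗ values X (l₁ , h₁) × k ∈ₗ values X (l₂ , h₂)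
  from k∈ with ∈-++⁻ (l₁ ∩ₗ l₂) {map (_+ (X + X)) (h₁ ∩ₗ h₂)} k∈
  ... | inj₁ k∈l with k∈l₁ , k∈l₂ ← ∈-filter⁻ (_∈ₗ? l₂) {xs = l₁} k∈l = ∈-++⁺ˡ k∈l₁ , ∈-++⁺ˡ k∈l₂
  ... | inj₂ k∈h with o , o∈h , refl ← ∈-map⁻ (_+ (X + X)) k∈h
                 with o∈h₁ , o∈h₂ ← ∈-filter⁻ (_∈ₗ? h₂) {xs = h₁} o∈h =
    ∈-++⁺ʳ l₁ (∈-map⁺ (_+ (X + X)) o∈h₁) , ∈-++⁺ʳ l₂ (∈-map⁺ (_+ (X + X)) o∈h₂)

Admissibleˢ : Shape → Set
Admissibleˢ ([]            , [])            = ⊤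
Admissibleˢ ([]            , _ ∷ [])        = ⊤
Admissibleˢ ([]            , o ∷ o′ ∷ [])   = o′ ≡ suc o
Admissibleˢ ([]            , _ ∷ _ ∷ _ ∷ _) = ⊥
Admissibleˢ (_ ∷ []        , [])            = ⊤
Admissibleˢ (_ ∷ []        , _ ∷ _)         = ⊥
Admissibleˢ (u ∷ u′ ∷ []   , [])            = u′ ≡ suc u
Admissibleˢ (_ ∷ _ ∷ []    , _ ∷ _)         = ⊥
Admissibleˢ (_ ∷ _ ∷ _ ∷ _ , _)             = ⊥

admissibleˢ? : ∀ s → Dec (Admissibleˢ s)
admissibleˢ? ([]            , [])            = yes tt
admissibleˢ? ([]            , _ ∷ [])        = yes tt
admissibleˢ? ([]            , o ∷ o′ ∷ [])   = o′ ≟ suc o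
admissibleˢ? ([]            , _ ∷ _ ∷ _ ∷ _) = no λ ()
admissibleˢ? (_ ∷ []        , [])            = yes tt
admissibleˢ? (_ ∷ []        , _ ∷ _)         = no λ ()
admissibleˢ? (u ∷ u′ ∷ []   , [])            = u′ ≟ suc u
admissibleˢ? (_ ∷ _ ∷ []    , _ ∷ _)         = no λ ()
admissibleˢ? (_ ∷ _ ∷ _ ∷ _ , _)             = no λ ()

Compatible : Shape → Shape → Set
Compatible s t = Separated s t × Admissibleˢ (s ⊓ t)

Apart : Shape → Shape → Set
Apart (l₁ , h₁) (l₂ , h₂) = Separated (l₁ , h₁) (l₂ , h₂) × Below h₁ h₂ × length (l₁ ∩ₗ l₂) ≤ 1

Wrap : ℕ → Shape
Wrap w = 0 ∷ [] , w ∷ []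

below? : ∀ V W → Dec (Below V W)
below? V W = All.all? (λ v → All.all? (v <?_) W) V

separated? : ∀ s t → Dec (Separated s t)
separated? (l₁ , h₁) (l₂ , h₂) = below? l₁ h₂ ×-dec below? l₂ h₁

compatible? : ∀ s t → Dec (Compatible s t)
compatible? s t = separated? s t ×-dec admissibleˢ? (s ⊓ t)

apart? : ∀ s t → Dec (Apart s t)
apart? (l₁ , h₁) (l₂ , h₂) = separated? (l₁ , h₁) (l₂ , h₂) ×-dec below? h₁ h₂ ×-dec length (l₁ ∩ₗ l₂) ≤? 1

below-raise-mono : ∀ {V W e d} → e ≤ d → Below V (map (_+ e) W) → Below V (map (_+ d) W)
below-raise-mono e≤d =
  All.map (λ v<W+e → All.map⁺ (All.map (λ v<o+e → ≤-trans v<o+e (+-monoʳ-≤ _ e≤d)) (All.map⁻ v<W+e)))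

apart-mono : ∀ {s t e d} → e ≤ d → Apart s (raise e t) → Apart s (raise d t)
apart-mono e≤d ((l₁<h₂ , l₂<h₁) , h₁<h₂ , sparse) =
  (below-raise-mono e≤d l₁<h₂ , l₂<h₁) , below-raise-mono e≤d h₁<h₂ , sparse

apart⇒compatible : ∀ {s t} → Apart s t → Compatible s t
apart⇒compatible {l₁ , h₁} {l₂ , h₂} (sep , h₁<h₂ , sparse) =
  sep , subst (λ h → Admissibleˢ (l₁ ∩ₗ l₂ , h)) (sym no-high-meet) (sparse-admissible sparse)
  where
  no-high-meet : h₁ ∩ₗ h₂ ≡ []
  no-high-meet = List.filter-none (_∈ₗ? h₂) (All.map (λ o<h₂ o∈h₂ → <-irrefl refl (All.lookup o<h₂ o∈h₂)) h₁<h₂)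
  sparse-admissible : ∀ {l} → length l ≤ 1 → Admissibleˢ (l , [])
  sparse-admissible {[]}        _         = tt
  sparse-admissible {_ ∷ []}    _         = tt
  sparse-admissible {_ ∷ _ ∷ _} (s≤s ())

module _ {n : ℕ} where

  open Realisation n

  realise-admissible : ∀ X e → Admissibleˢ e → All (_< n) (values X e) → Admissible ⟦ values X e ⟧
  realise-admissible X ([]         , [])         _    _               = inj₁ (≤-trans (∣⟦⟧∣≤length []) z≤n)
  realise-admissible X ([]         , o ∷ [])     _    _               = inj₁ (∣⟦⟧∣≤length (o + (X + X) ∷ []))
  realise-admissible X (u ∷ []     , [])         _    _               = inj₁ (∣⟦⟧∣≤length (u ∷ []))
  realise-admissible X ([]         , _ ∷ _ ∷ []) refl (_ ∷ 1+u<n ∷ []) = inj₂ (step-cycleEdge 1+u<n)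
  realise-admissible X (_ ∷ _ ∷ [] , [])         refl (_ ∷ 1+u<n ∷ []) = inj₂ (step-cycleEdge 1+u<n)

  meet-realised : ∀ {s t} → Separated s t → ∀ X → ⟦ values X s ⟧ ∩ ⟦ values X t ⟧ ≡ ⟦ values X (s ⊓ t) ⟧
  meet-realised sep X = ⟦⟧-∩ (meet sep X)

  compatible-admissible : ∀ {s t X} → Compatible s t → All (_< n) (values X s) →
                          Admissible (⟦ values X s ⟧ ∩ ⟦ values X t ⟧)
  compatible-admissible {s} {t} {X} (sep , adm) s<n =
    subst Admissible (sym (meet-realised sep X)) (realise-admissible X (s ⊓ t) adm meet<n)
    where
    meet<n : All (_< n) (values X (s ⊓ t))
    meet<n = All.tabulate (λ k∈ → All.lookup s<n (proj₁ (Equivalence.from (meet sep X _) k∈)))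

  admissible-at : ∀ X s t {V W} → V ≡ values X s → W ≡ values X t → Compatible s t → All (_< n) V →
                  Admissible (⟦ V ⟧ ∩ ⟦ W ⟧)
  admissible-at X s t refl refl = compatible-admissible {s} {t} {X}

  wrap-admissible : ∀ {s t w X} → Separated s t → s ⊓ t ≡ Wrap w → n ≡ suc (w + (X + X)) →
                    Admissible (⟦ values X s ⟧ ∩ ⟦ values X t ⟧)
  wrap-admissible {X = X} sep s⊓t≡wrap n≡ = inj₂ (subst IsCycleEdge (sym realised) (wrap-cycleEdge n≡))
    where
    realised = trans (meet-realised sep X) (trans (cong (⟦_⟧ ∘ values X) s⊓t≡wrap) ⟦⟧-swap)

-- Chains and gadgets

chain : Shape
chain = [] , 0 ∷ 1 ∷ 2 ∷ 3 ∷ 7 ∷ 8 ∷ []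

chain-unique : ∀ a → Unique (values a chain)
chain-unique a = Unique.map⁺ (λ {x} {y} → +-cancelʳ-≡ (a + a) x y) (from-yes (unique? (proj₂ chain)))

chain-bound : ∀ {n} a → 8 + (a + a) < n → All (_< n) (values a chain)
chain-bound a 8+2a<n = All.map⁺ (All.map (λ p≤8 → ≤-<-trans (+-monoˡ-≤ (a + a) p≤8) 8+2a<n) pattern≤8)
  where
  pattern≤8 : All (_≤ 8) (proj₂ chain)
  pattern≤8 = from-yes (All.all? (_≤? 8) (proj₂ chain))

chains-near : All (λ d → Compatible chain (raise (suc d + suc d) chain)) (upTo 4)
chains-near = from-yes (All.all? (λ d → compatible? chain (raise (suc d + suc d) chain)) (upTo 4))

chains-far : Apart chain (raise 10 chain)
chains-far = from-yes (apart? chain (raise 10 chain))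

chains-compatible : ∀ d → Compatible chain (raise (suc d + suc d) chain)
chains-compatible d with d <? 4
... | yes d<4 = All.lookup chains-near (∈-upTo⁺ d<4)
... | no  d≮4 = apart⇒compatible (apart-mono {s = chain} {t = chain} (+-mono-≤ (s≤s 4≤d) (s≤s 4≤d)) chains-far)
  where 4≤d = ≮⇒≥ d≮4

module _ {n : ℕ} where

  open Realisation n

  chains-admissible : ∀ {a b} → a ≢ b → All (_< n) (values a chain) → All (_< n) (values b chain) →
                      Admissible (⟦ values a chain ⟧ ∩ ⟦ values b chain ⟧)
  chains-admissible {a} {b} a≢b a<n b<n with ≤-or-gap a b
  ... | inj₁ (zero  , refl) = ⊥-elim (a≢b refl)
  ... | inj₁ (suc d , refl) =
    admissible-at a chain (raise (suc d + suc d) chain) refl (values-raise (suc d) a chain)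
                  (chains-compatible d) a<n
  ... | inj₂ (d , refl) = subst Admissible (∩-comm _ _)
    (admissible-at b chain (raise (suc d + suc d) chain) refl (values-raise (suc d) b chain)
                   (chains-compatible d) b<n)

  chains-meet : ∀ a d {c} → Separated chain (raise (suc d + suc d) chain) → chain ⊓ raise (suc d + suc d) chain ≡ c →
                ⟦ values a chain ⟧ ∩ ⟦ values (suc d + a) chain ⟧ ≡ ⟦ values a c ⟧
  chains-meet a d sep refl =
    trans (cong (λ V → ⟦ values a chain ⟧ ∩ ⟦ V ⟧) (values-raise (suc d) a chain)) (meet-realised sep a)

-- The four regimes of chain a against a gadget at height K: a < 4 (for K = 0, and for K > 0
-- with the gadget one step up); a = 4 + b with K = r + b, seen from height b, where r ≥ 3 is
-- Apart; and a = c + K with c ≥ 5.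
ChainCompatible : ℕ → Shape → Set
ChainCompatible M g =
    All (λ a → Compatible (freeze a chain) (freeze 0 g) × Compatible (freeze a chain) (raise 2 g)) (upTo 4)
  × All (λ r → Compatible (raise 8 chain) (raise (r + r) g)) (upTo 3)
  × Apart (raise 8 chain) (raise 6 g)
  × All (λ c → 5 ≤ c → Compatible (raise (c + c) chain) g) (upTo M)

chainCompatible? : ∀ M g → Dec (ChainCompatible M g)
chainCompatible? M g =
        All.all? (λ a → compatible? (freeze a chain) (freeze 0 g) ×-dec compatible? (freeze a chain) (raise 2 g))
                 (upTo 4)
  ×-dec All.all? (λ r → compatible? (raise 8 chain) (raise (r + r) g)) (upTo 3)
  ×-dec apart? (raise 8 chain) (raise 6 g)
  ×-dec All.all? (λ c → (5 ≤? c) →-dec compatible? (raise (c + c) chain) g) (upTo M)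

module _ {n : ℕ} where

  open Realisation n

  chain-meets-gadget : ∀ {M g} → ChainCompatible M g → ∀ K a → a < M + K → All (_< n) (values a chain) →
                       Admissible (⟦ values a chain ⟧ ∩ ⟦ values K g ⟧)
  chain-meets-gadget {M} {g} (low , middle , far , high) K a a<M+K a<n with a <? 4
  ... | yes a<4 with All.lookup low (∈-upTo⁺ a<4) | K
  ...   | at-0 , _ | zero  = admissible-at 0 (freeze a chain) (freeze 0 g)
                               (sym (values-freeze a 0 chain)) (sym (values-freeze 0 0 g)) at-0 a<n
  ...   | _ , at-s | suc K = admissible-at K (freeze a chain) (raise 2 g)
                               (sym (values-freeze a K chain)) (values-raise 1 K g) at-s a<n
  chain-meets-gadget {M} {g} (low , middle , far , high) K a a<M+K a<n | no a≮4
    with b , refl ← m≤n⇒∃[o]m+o≡n (≮⇒≥ a≮4) with ≤-or-gap b K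
  ... | inj₁ (r , refl) = admissible-at b (raise 8 chain) (raise (r + r) g)
                            (values-raise 4 b chain) (values-raise r b g) compatible a<n
    where
    compatible : Compatible (raise 8 chain) (raise (r + r) g)
    compatible with r <? 3
    ... | yes r<3 = All.lookup middle (∈-upTo⁺ r<3)
    ... | no  r≮3 = apart⇒compatible (apart-mono {s = raise 8 chain} {t = g} (+-mono-≤ 3≤r 3≤r) far)
      where 3≤r = ≮⇒≥ r≮3
  ... | inj₂ (t , refl) = admissible-at K (raise (c + c) chain) g (values-raise c K chain) refl
                            (All.lookup high (∈-upTo⁺ c<M) (s≤s (s≤s (s≤s (s≤s (s≤s z≤n)))))) a<n
    where
    c = 5 + t
    c<M : c < M
    c<M = +-cancelʳ-< K c M a<M+K

-- Blueprints

Fits : ℕ → Shape → Set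
Fits W (low , high) =
  Unique low × Unique high × Below low high × All (_≤ W) low × All (_≤ W) high × length low + length high ≡ 6

fits? : ∀ W g → Dec (Fits W g)
fits? W (low , high) =
  unique? low ×-dec unique? high ×-dec below? low high ×-dec All.all? (_≤? W) low ×-dec All.all? (_≤? W) high
  ×-dec length low + length high ≟ 6

fits-unique : ∀ {W} K g → Fits W g → Unique (values K g)
fits-unique K (low , high) (low! , high! , low<high , _) =
  Unique.++⁺ low! (Unique.map⁺ (λ {x} {y} → +-cancelʳ-≡ (K + K) x y) high!)
             (λ (k∈low , k∈high) → below-raised low<high k∈low k∈high)

fits-length : ∀ {W} K g → Fits W g → length (values K g) ≡ 6
fits-length K (low , high) (_ , _ , _ , _ , _ , size) =
  trans (List.length-++ low) (trans (cong (length low +_) (List.length-map (_+ (K + K)) high)) size)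

fits-bound : ∀ {W} K g → Fits W g → All (_< suc (W + (K + K))) (values K g)
fits-bound {W} K (low , high) (_ , _ , _ , low≤W , high≤W , _) =
  All.++⁺ (All.map (λ l≤W → s≤s (≤-trans l≤W (m≤m+n W (K + K)))) low≤W)
          (All.map⁺ (All.map (λ o≤W → s≤s (+-monoˡ-≤ (K + K) o≤W)) high≤W))

GadgetCompatible : ℕ → Shape → Shape → Set
GadgetCompatible W s t = Separated s t × (Admissibleˢ (s ⊓ t) ⊎ s ⊓ t ≡ Wrap W)

_≟ˢ_ : (s t : Shape) → Dec (s ≡ t)
_≟ˢ_ = ≡-dec (List.≡-dec _≟_) (List.≡-dec _≟_)

gadgetCompatible? : ∀ W s t → Dec (GadgetCompatible W s t)
gadgetCompatible? W s t = separated? s t ×-dec (admissibleˢ? (s ⊓ t) ⊎-dec (s ⊓ t) ≟ˢ Wrap W)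

-- At K, early c names chain c and late c names chain c + K.
data Anchor (G : ℕ) : Set where
  early  : ℕ → Anchor G
  late   : ℕ → Anchor G
  gadget : Fin G → Anchor G

-- The edges {u, u+1} near 0 that no two chains meet in.
frontGaps : List ℕ
frontGaps = 0 ∷ 1 ∷ 3 ∷ 5 ∷ []

-- The instance at K has n = top + 2K + 1 vertices, chains + K chain hyperedges and the gadgets.
-- front u, back t and wrap name the hyperedges meeting in {u, u+1}, in the t-th edge after the
-- last one two chains meet in, and in {n-1, 0}.
record Blueprint : Set where
  field
    chains  : ℕ
    tail    : ℕ
    gadgets : List Shape
    front   : ℕ → Anchor (length gadgets) × Anchor (length gadgets)
    back    : ℕ → Anchor (length gadgets) × Anchor (length gadgets)
    wrap    : Anchor (length gadgets) × Anchor (length gadgets)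

  G : ℕ
  G = length gadgets

  top : ℕ
  top = (chains + chains) + tail

  order : ℕ → ℕ
  order K = suc (top + (K + K))

  gadget-shape : Fin G → Shape
  gadget-shape = lookup gadgets

  anchor : Anchor G → Shape
  anchor (early c)  = freeze c chain
  anchor (late c)   = raise (c + c) chain
  anchor (gadget g) = gadget-shape g

  Anchored : Anchor G → Set
  Anchored (early c)  = c < chains
  Anchored (late c)   = c < chains
  Anchored (gadget _) = ⊤

  anchored? : ∀ p → Dec (Anchored p)
  anchored? (early c)  = c <? chains
  anchored? (late c)   = c <? chains
  anchored? (gadget _) = yes tt

  Covers : Anchor G × Anchor G → Shape → Set
  Covers (p , q) c = Anchored p × Anchored q × Separated (anchor p) (anchor q) × anchor p ⊓ anchor q ≡ c

  covers? : ∀ pq c → Dec (Covers pq c)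
  covers? (p , q) c =
    anchored? p ×-dec anchored? q ×-dec separated? (anchor p) (anchor q) ×-dec (anchor p ⊓ anchor q) ≟ˢ c

  back-edge : ℕ → Shape
  back-edge t = [] , (chains + chains) + t ∷ suc ((chains + chains) + t) ∷ []

  GadgetsCompatible : Set
  GadgetsCompatible =
    All (λ g → All (λ h → g ≡ h ⊎ GadgetCompatible top (gadget-shape g) (gadget-shape h)) (allFin G)) (allFin G)

  -- 6 ≤ tail keeps the last chain, which reaches vertex 2(chains + K) + 6, inside the cycle.
  record Valid : Set where
    field
      tail≥6          : 6 ≤ tail
      gadgets-fit     : All (Fits top) gadgets
      chains-gadgets  : All (ChainCompatible chains) gadgets
      gadgets-gadgets : GadgetsCompatible
      front-covers    : All (λ u → Covers (front u) (u ∷ suc u ∷ [] , [])) frontGaps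
      back-covers     : All (λ t → Covers (back t) (back-edge t)) (upTo tail)
      wrap-covers     : Covers wrap (Wrap top)

  valid? : Dec Valid
  valid? = map′ (λ (a , b , c , d , e , f , g) → record
                  { tail≥6 = a ; gadgets-fit = b ; chains-gadgets = c ; gadgets-gadgets = d
                  ; front-covers = e ; back-covers = f ; wrap-covers = g })
                (λ v → let open Valid v in
                  tail≥6 , gadgets-fit , chains-gadgets , gadgets-gadgets , front-covers , back-covers , wrap-covers)
    (6 ≤? tail
     ×-dec All.all? (fits? top) gadgets
     ×-dec All.all? (chainCompatible? chains) gadgets
     ×-dec All.all? (λ g → All.all? (λ h → (g Fin.≟ h) ⊎-dec gadgetCompatible? top (gadget-shape g) (gadget-shape h))
                                    (allFin G)) (allFin G)
     ×-dec All.all? (λ u → covers? (front u) (u ∷ suc u ∷ [] , [])) frontGaps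
     ×-dec All.all? (λ t → covers? (back t) (back-edge t)) (upTo tail)
     ×-dec covers? wrap (Wrap top))

module Construction (b : Blueprint) (valid : Blueprint.Valid b) (K : ℕ) where

  open Blueprint b
  open Valid valid

  n L : ℕ
  n = order K
  L = chains + K

  open Realisation n

  chain-edge : Fin L → Subset n
  chain-edge a = ⟦ values (toℕ a) chain ⟧

  gadget-edge : Fin G → Subset n
  gadget-edge g = ⟦ values K (gadget-shape g) ⟧

  edge : Fin (L + G) → Subset n
  edge i = [ chain-edge , gadget-edge ]′ (splitAt L i)

  chain-fits : ∀ {a} → a < L → 8 + (a + a) < n
  chain-fits {a} a<L = s≤s (begin
    8 + (a + a)         ≡⟨ regroup a ⟩
    6 + (suc a + suc a) ≤⟨ +-mono-≤ tail≥6 (+-mono-≤ a<L a<L) ⟩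
    tail + (L + L)      ≡⟨ spread chains tail K ⟩
    top + (K + K)       ∎)
    where
    open ≤-Reasoning
    regroup : ∀ a → 8 + (a + a) ≡ 6 + (suc a + suc a)
    regroup = solve-∀
    spread : ∀ M B K → B + ((M + K) + (M + K)) ≡ ((M + M) + B) + (K + K)
    spread = solve-∀

  gadget-fits : ∀ g → Fits top (gadget-shape g)
  gadget-fits g = All.lookup gadgets-fit (∈-lookup g)

  chain-values-fit : (a : Fin L) → All (_< n) (values (toℕ a) chain)
  chain-values-fit a = chain-bound (toℕ a) (chain-fits (toℕ<n a))

  size : ∀ i → ∣ edge i ∣ ≡ 6
  size i with splitAt L i
  ... | inj₁ a = ∣⟦⟧∣≡length (chain-unique (toℕ a)) (chain-values-fit a)
  ... | inj₂ g = trans (∣⟦⟧∣≡length (fits-unique K _ (gadget-fits g)) (fits-bound K _ (gadget-fits g)))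
                       (fits-length K _ (gadget-fits g))

  chain-meets : (a : Fin L) (g : Fin G) → Admissible (chain-edge a ∩ gadget-edge g)
  chain-meets a g =
    chain-meets-gadget (All.lookup chains-gadgets (∈-lookup g)) K (toℕ a) (toℕ<n a) (chain-values-fit a)

  admissible : ∀ {i j} → i ≢ j → Admissible (edge i ∩ edge j)
  admissible {i} {j} i≢j with splitAt L i in eqi | splitAt L j in eqj
  ... | inj₁ a | inj₁ b = chains-admissible a≢b (chain-values-fit a) (chain-values-fit b)
    where
    a≢b : toℕ a ≢ toℕ b
    a≢b e = i≢j (trans (sym (splitAt⁻¹-↑ˡ eqi)) (trans (cong (_↑ˡ G) (toℕ-injective e)) (splitAt⁻¹-↑ˡ eqj)))
  ... | inj₁ a | inj₂ g = chain-meets a g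
  ... | inj₂ g | inj₁ a = subst Admissible (∩-comm (chain-edge a) (gadget-edge g)) (chain-meets a g)
  ... | inj₂ g | inj₂ h with All.lookup (All.lookup gadgets-gadgets (∈-allFin g)) (∈-allFin h)
  ...   | inj₁ refl = ⊥-elim (i≢j (trans (sym (splitAt⁻¹-↑ʳ eqi)) (splitAt⁻¹-↑ʳ eqj)))
  ...   | inj₂ (sep , inj₁ adm) =
    compatible-admissible {s = gadget-shape g} {t = gadget-shape h} {X = K} (sep , adm)
                          (fits-bound K _ (gadget-fits g))
  ...   | inj₂ (sep , inj₂ meet≡wrap) =
    wrap-admissible {s = gadget-shape g} {t = gadget-shape h} {w = top} {X = K} sep meet≡wrap refl

  Covered : List ℕ → Set
  Covered V = ∃₂ λ i j → edge i ∩ edge j ≡ ⟦ V ⟧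

  chain-index : ∀ {a} → a < L → Fin (L + G)
  chain-index a<L = fromℕ< a<L ↑ˡ G

  edge-chain : ∀ {a} (a<L : a < L) → edge (chain-index a<L) ≡ ⟦ values a chain ⟧
  edge-chain a<L rewrite splitAt-↑ˡ L (fromℕ< a<L) G | toℕ-fromℕ< a<L = refl

  anchor-index : (p : Anchor G) → Anchored p → Fin (L + G)
  anchor-index (early c)  c<M = chain-index (≤-trans c<M (m≤m+n chains K))
  anchor-index (late c)   c<M = chain-index (+-monoˡ-< K c<M)
  anchor-index (gadget g) _   = L ↑ʳ g

  edge-anchor : ∀ p p-ok → edge (anchor-index p p-ok) ≡ ⟦ values K (anchor p) ⟧
  edge-anchor (early c)  c<M =
    trans (edge-chain (≤-trans c<M (m≤m+n chains K))) (cong ⟦_⟧ (sym (values-freeze c K chain)))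
  edge-anchor (late c)   c<M = trans (edge-chain (+-monoˡ-< K c<M)) (cong ⟦_⟧ (values-raise c K chain))
  edge-anchor (gadget g) _ rewrite splitAt-↑ʳ L G g = refl

  covered-by : ∀ {pq c} → Covers pq c → Covered (values K c)
  covered-by {p , q} (p-ok , q-ok , sep , refl) =
    anchor-index p p-ok , anchor-index q q-ok ,
    trans (cong₂ _∩_ (edge-anchor p p-ok) (edge-anchor q q-ok)) (meet-realised sep K)

  chains-cover : ∀ a d {c} → suc d + a < L → chain ⊓ raise (suc d + suc d) chain ≡ c → Covered (values a c)
  chains-cover a d a+d<L meet≡ =
    chain-index a<L , chain-index a+d<L ,
    trans (cong₂ _∩_ (edge-chain a<L) (edge-chain a+d<L)) (chains-meet a d (proj₁ (chains-compatible d)) meet≡)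
    where
    a<L = ≤-<-trans (m≤n+m a (suc d)) a+d<L

  step-cover : ∀ u → suc u < n → Covered (u ∷ suc u ∷ [])
  step-cover u 1+u<n with u <? L + L
  ... | yes u<2L with halve {u} {L} u<2L
  ... | zero , _ , inj₁ refl = covered-by (All.lookup front-covers (here refl))
  ... | suc a , a<L , inj₁ refl =
    subst (λ w → Covered (w ∷ suc w ∷ [])) (sym (even a)) (chains-cover a 0 {[] , 2 ∷ 3 ∷ []} a<L refl)
    where
    even : ∀ a → suc a + suc a ≡ 2 + (a + a)
    even = solve-∀
  ... | 0 , _ , inj₂ refl = covered-by (All.lookup front-covers (there (here refl)))
  ... | 1 , _ , inj₂ refl = covered-by (All.lookup front-covers (there (there (here refl))))
  ... | 2 , _ , inj₂ refl = covered-by (All.lookup front-covers (there (there (there (here refl)))))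
  ... | suc (suc (suc a)) , a+3<L , inj₂ refl =
    subst (λ w → Covered (w ∷ suc w ∷ [])) (sym (odd a)) (chains-cover a 2 {[] , 7 ∷ 8 ∷ []} a+3<L refl)
    where
    odd : ∀ a → suc ((3 + a) + (3 + a)) ≡ 7 + (a + a)
    odd = solve-∀
  step-cover u 1+u<n | no u≮2L with t , refl ← m≤n⇒∃[o]m+o≡n (≮⇒≥ u≮2L) =
    subst (λ w → Covered (w ∷ suc w ∷ [])) (sym (past-chains chains K t))
          (covered-by (All.lookup back-covers (∈-upTo⁺ t<tail)))
    where
    past-chains : ∀ M K t → ((M + K) + (M + K)) + t ≡ ((M + M) + t) + (K + K)
    past-chains = solve-∀
    t<tail : t < tail
    t<tail = +-cancelˡ-< (chains + chains) t tail (+-cancelʳ-< (K + K) _ _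
               (subst (_< top + (K + K)) (past-chains chains K t) (≤-pred 1+u<n)))

  covered : ∀ {x y : Fin n} → CycleSucc x y → ∃₂ λ i j → edge i ∩ edge j ≡ ⁅ x ⁆ ∪ ⁅ y ⁆
  covered {x} {y} (inj₁ y≡1+x) with i , j , meet≡ ← step-cover (toℕ x) (subst (_< n) y≡1+x (toℕ<n y)) =
    i , j , trans meet≡ (⟦⟧-edge refl y≡1+x)
  covered (inj₂ (x≡n-1 , y≡0)) with i , j , meet≡ ← covered-by wrap-covers =
    i , j , trans meet≡ (trans (⟦⟧-swap {0} {top + (K + K)}) (⟦⟧-edge x≡n-1 y≡0))

  2≤n : 2 ≤ n
  2≤n = s≤s (≤-trans (≤-trans (s≤s z≤n) tail≥6) (≤-trans (m≤n+m tail (chains + chains)) (m≤m+n top (K + K))))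

  realisation : Σ (Hypergraph n) λ H → Uniform 6 H × EIisCycle H × length (edges H) ≡ L + G
  realisation = Certified.certified edge 2≤n (s≤s (s≤s (s≤s z≤n))) size admissible covered

even : Blueprint
even = record
  { chains  = 8
  ; tail    = 7
  ; gadgets = (0 ∷ [] , 16 ∷ 17 ∷ 18 ∷ 19 ∷ 23 ∷ [])
            ∷ (1 ∷ 2 ∷ [] , 18 ∷ 19 ∷ 20 ∷ 21 ∷ [])
            ∷ (3 ∷ 4 ∷ [] , 20 ∷ 21 ∷ 22 ∷ 23 ∷ [])
            ∷ (0 ∷ 1 ∷ 5 ∷ 6 ∷ [] , 22 ∷ 23 ∷ [])
            ∷ []
  ; front   = λ { 0 → early 0 , gadget (# 3) ; 1 → early 0 , gadget (# 1) ; 3 → early 1 , gadget (# 2)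
                ; _ → early 2 , gadget (# 3) }
  ; back    = λ { 0 → late 7 , gadget (# 0) ; 1 → late 5 , gadget (# 0) ; 2 → gadget (# 0) , gadget (# 1)
                ; 3 → late 6 , gadget (# 1) ; 4 → gadget (# 1) , gadget (# 2) ; 5 → late 7 , gadget (# 2)
                ; _ → gadget (# 2) , gadget (# 3) }
  ; wrap    = gadget (# 0) , gadget (# 3)
  }

odd : Blueprint
odd = record
  { chains  = 9
  ; tail    = 6
  ; gadgets = (3 ∷ 4 ∷ [] , 18 ∷ 19 ∷ 20 ∷ 21 ∷ [])
            ∷ (1 ∷ 2 ∷ [] , 20 ∷ 21 ∷ 22 ∷ 23 ∷ [])
            ∷ (0 ∷ 5 ∷ 6 ∷ [] , 22 ∷ 23 ∷ 24 ∷ [])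
            ∷ (0 ∷ 1 ∷ 4 ∷ [] , 14 ∷ 15 ∷ 24 ∷ [])
            ∷ []
  ; front   = λ { 0 → early 0 , gadget (# 3) ; 1 → early 0 , gadget (# 1) ; 3 → early 1 , gadget (# 0)
                ; _ → early 2 , gadget (# 2) }
  ; back    = λ { 0 → late 8 , gadget (# 0) ; 1 → late 6 , gadget (# 0) ; 2 → gadget (# 0) , gadget (# 1)
                ; 3 → late 7 , gadget (# 1) ; 4 → gadget (# 1) , gadget (# 2) ; _ → late 8 , gadget (# 2) }
  ; wrap    = gadget (# 2) , gadget (# 3)
  }

Optimal : ℕ → Set
Optimal n = Σ (Hypergraph n) λ H → Uniform 6 H × EIisCycle H × length (edges H) ≡ ⌈ n /2⌉

resize : ∀ {n m m′} → m ≡ m′ →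
         Σ (Hypergraph n) (λ H → Uniform 6 H × EIisCycle H × length (edges H) ≡ m) →
         Σ (Hypergraph n) (λ H → Uniform 6 H × EIisCycle H × length (edges H) ≡ m′)
resize m≡m′ (H , uniform , ei , size) = H , uniform , ei , trans size m≡m′

even-valid : Blueprint.Valid even
even-valid = from-yes (Blueprint.valid? even)

odd-valid : Blueprint.Valid odd
odd-valid = from-yes (Blueprint.valid? odd)

optimal-24+ : ∀ m → Optimal (24 + m)
optimal-24+ m with parity m
... | K , inj₁ refl = resize (trans (cong (8 +_) (+-comm K 4)) (cong (12 +_) (n≡⌈n+n/2⌉ K)))
                             (Construction.realisation even even-valid K)
... | K , inj₂ refl = resize (trans (cong (9 +_) (+-comm K 4)) (cong (13 +_) (n≡⌊n+n/2⌋ K)))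
                             (Construction.realisation odd odd-valid K)

optimal : ∀ n → 24 ≤ n → Optimal n
optimal n 24≤n = subst Optimal (proj₂ (m≤n⇒∃[o]m+o≡n 24≤n)) (optimal-24+ _)

corollary2 : (n : ℕ) → 24 ≤ n →
    Σ (Hypergraph n) (λ H → Uniform 6 H × EIisCycle H × length (edges H) ≡ ⌈ n /2⌉)
    × ((H : Hypergraph n) → Uniform 6 H → EIisCycle H → ⌈ n /2⌉ ≤ length (edges H))
corollary2 n 24≤n = optimal n 24≤n , λ H → half-bound H (≤-trans (s≤s (s≤s (s≤s z≤n))) 24≤n)
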